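{- Let $n\ge1$ and let $\lambda\in P(n)$ be a partition at which $N(1,3;\lambda)$ attains its maximum over $P(n)$. For $i\ge1$ let $m_i$ be the number of parts of $\lambda$ equal to $i$. If $a>b$ are integers with $a,b\notin\{2,14\}$ and $m_a=m_b=1$, then $(a,b)\in\{(12,11),(15,12),(17,15)\}$.
   Context: $P(n)$ is the set of partitions of $n$. $N(1,3;m)$ is the number of partitions of $m$ whose rank (largest part minus number of parts) is $\equiv1\pmod3$, and for $\lambda=(\lambda_1,\dots,\lambda_k)$, $N(1,3;\lambda):=\prod_{j=1}^kN(1,3;\lambda_j)$. -}

module Defs where

open import Data.Nat using (ℕ; zero; suc; _≤_; _≥_; _≤ᵇ_; _≡ᵇ_; _∸_)
open import Data.Nat.Properties using (_≟_)
open import Data.Integer as ℤ using (ℤ; +_; _-_; _%ℕ_)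
open import Data.List using (List; []; _∷_; length; map; concatMap; applyUpTo; filterᵇ; filter)
open import Data.Nat.ListAction using (sum; product)
open import Data.List.Relation.Unary.All using (All)
open import Data.List.Relation.Unary.Linked using (Linked)
open import Data.Bool using (Bool)
open import Relation.Binary.PropositionalEquality using (_≡_)
open import Relation.Nullary.Decidable using (⌊_⌋)

record IsPartition (n : ℕ) (λs : List ℕ) : Set where
  field
    positive   : All (λ x → 1 ≤ x) λs
    decreasing : Linked _≥_ λs
    sums       : sum λs ≡ n

largest : List ℕ → ℕ
largest []      = 0
largest (x ∷ _) = x

rank : List ℕ → ℤ
rank λs = + largest λs - + length λs

partsBounded : ℕ → ℕ → ℕ → List (List ℕ)
partsBounded _          zero    _ = [] ∷ []
partsBounded zero       (suc m) _ = []
partsBounded (suc fuel) m       k =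
  concatMap (λ j → map (j ∷_) (partsBounded fuel (m ∸ j) j))
            (filterᵇ (λ j → j ≤ᵇ m) (applyUpTo suc k))

partitions : ℕ → List (List ℕ)
partitions m = partsBounded m m m

rankIs1mod3 : List ℕ → Bool
rankIs1mod3 λs = (rank λs %ℕ 3) ≡ᵇ 1

N13 : ℕ → ℕ
N13 m = length (filterᵇ rankIs1mod3 (partitions m))

N13λ : List ℕ → ℕ
N13λ λs = product (map N13 λs)

mult : ℕ → List ℕ → ℕ
mult i λs = length (filter (λ x → x ≟ i) λs)

{-# OPTIONS --safe #-}
module Submission where

-- Since N(1,3;·) is multiplicative over parts, replacing a
-- sub-multiset S of the parts by positive parts T with the same sum gives a partition of n, so
-- N(1,3;T) ≤ N(1,3;S) whenever N(1,3;λ) > 0, which holds for n ≥ 2 (split n into 2s and 3s).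
-- A single part a = 22 + 14q + r (r < 14) is beaten by q parts 14 followed by one of fourteen
-- short partitions of 22 + r: for q = 0 by tabulated values of N(1,3;m), for 1 ≤ q ≤ 4 through
-- the partition count p(a), computed by dynamic programming, and for q ≥ 5 because
-- p(a) ≤ 1401 (6/5)^a (the generating-function bound at x = 5/6) while N(1,3;14) = 46 > (6/5)^14.
-- Two distinct parts b < a < 22 are beaten by a partition of a + b except for seven pairs, found
-- by a finite check; discarding those containing 14 leaves the three of the statement.

open import Defs
open import Data.Nat
open import Data.Nat.Properties
open import Data.Nat.DivMod using (_/_; _%_; m%n<n; m≡m%n+[m/n]*n)
open import Data.Nat.ListAction using (sum; product)
open import Data.Nat.ListAction.Properties using (sum-↭; product-↭; sum-++; product-++)
open import Data.Nat.Tactic.RingSolver using (solve-∀)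
open import Data.Bool using (Bool; true; false; T; if_then_else_)
open import Data.Unit using (tt)
open import Data.Empty using (⊥-elim)
open import Data.List
  using (List; []; _∷_; _++_; _∷ʳ_; drop; map; length; concatMap; filterᵇ; applyUpTo; replicate)
open import Data.List.Properties
  using (map-++; filter-reject; length-++; length-map; length-filter; concatMap-++; filter-++; applyUpTo-∷ʳ)
open import Data.List.Relation.Unary.All as All using (All; []; _∷_; all?)
open import Data.List.Relation.Unary.All.Properties using (++⁺; ++⁻ʳ; replicate⁺)
open import Data.List.Relation.Unary.Any using (here; there)
open import Data.List.Membership.Propositional using (_∈_)
open import Data.List.Membership.Propositional.Properties using (∈-∃++)
open import Data.List.Relation.Binary.Permutation.Propositional using (_↭_; ↭-sym; ↭-trans; prep)
open import Data.List.Relation.Binary.Permutation.Propositional.Properties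
  using (All-resp-↭; ∈-resp-↭; map⁺; shift)
open import Data.Product using (Σ-syntax; _×_; _,_; proj₁; proj₂)
open import Data.Product.Properties using (≡-dec)
open import Data.List.Membership.DecPropositional (≡-dec _≟_ _≟_) using (_∈?_)
open import Data.Sum using (_⊎_; inj₁; inj₂; [_,_]′)
open import Function using (_∘_; id)
open import Relation.Nullary using (¬_; Dec; yes; no; contradiction)
open import Relation.Nullary.Decidable using (T?; from-yes; map′; _×-dec_; _⊎-dec_)
open import Relation.Binary.PropositionalEquality
import Data.List.Sort as Sort
import Relation.Binary.Construct.Flip.EqAndOrd as Flip

open Sort (Flip.decTotalOrder ≤-decTotalOrder) using (sort; sort-↭; sort-↗)

record IsComposition (n : ℕ) (xs : List ℕ) : Set where
  field
    positive : All (1 ≤_) xs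
    sums     : sum xs ≡ n

isPartition-sort : ∀ {n xs} → IsComposition n xs → IsPartition n (sort xs)
isPartition-sort {xs = xs} c = record
  { positive   = All-resp-↭ (↭-sym (sort-↭ xs)) positive
  ; decreasing = sort-↗ xs
  ; sums       = trans (sum-↭ (sort-↭ xs)) sums
  }
  where open IsComposition c

N13λ-↭ : ∀ {xs ys} → xs ↭ ys → N13λ xs ≡ N13λ ys
N13λ-↭ p = product-↭ (map⁺ N13 p)

N13λ-++ : ∀ xs ys → N13λ (xs ++ ys) ≡ N13λ xs * N13λ ys
N13λ-++ xs ys = trans (cong product (map-++ N13 xs ys)) (product-++ (map N13 xs) (map N13 ys))

mult≡suc⇒∈ : ∀ {a k} xs → mult a xs ≡ suc k → a ∈ xs
mult≡suc⇒∈ {a} (x ∷ xs) eq with x ≟ a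
... | yes refl = here refl
... | no x≢a   = there (mult≡suc⇒∈ xs (trans (cong length (sym (filter-reject (_≟ a) x≢a))) eq))

∈⇒≤sum : ∀ {x : ℕ} {xs} → x ∈ xs → x ≤ sum xs
∈⇒≤sum {xs = y ∷ ys} (here refl) = m≤m+n y (sum ys)
∈⇒≤sum {xs = y ∷ ys} (there p)   = ≤-trans (∈⇒≤sum p) (m≤n+m (sum ys) y)

∈⇒↭∷ : ∀ {x : ℕ} {xs} → x ∈ xs → Σ[ rest ∈ List ℕ ] xs ↭ x ∷ rest
∈⇒↭∷ {x} p with ∈-∃++ p
... | ys , zs , refl = ys ++ zs , shift x ys zs

∈×∈⇒↭∷∷ : ∀ {a b : ℕ} {xs} → a ∈ xs → b ∈ xs → a ≢ b → Σ[ rest ∈ List ℕ ] xs ↭ a ∷ b ∷ rest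
∈×∈⇒↭∷∷ {a} a∈ b∈ a≢b with ∈⇒↭∷ a∈
... | rest , xs↭ with ∈-resp-↭ xs↭ b∈
...   | here b≡a = contradiction (sym b≡a) a≢b
...   | there b∈rest with ∈⇒↭∷ b∈rest
...     | rest′ , rest↭ = rest′ , ↭-trans xs↭ (prep a rest↭)

twosAndThrees : ∀ n → 2 ≤ n → Σ[ T ∈ List ℕ ] IsComposition n T × N13λ T ≡ 1
twosAndThrees 1 (s≤s ())
twosAndThrees 2 _ = 2 ∷ [] , record { positive = s≤s z≤n ∷ [] ; sums = refl } , refl
twosAndThrees 3 _ = 3 ∷ [] , record { positive = s≤s z≤n ∷ [] ; sums = refl } , refl
twosAndThrees (suc (suc (suc (suc n)))) _ with twosAndThrees (2 + n) (s≤s (s≤s z≤n))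
... | T , c , N≡1 =
  2 ∷ T , record { positive = s≤s z≤n ∷ positive ; sums = cong (2 +_) sums } , trans (+-identityʳ _) N≡1
  where open IsComposition c

IsMaximal : ℕ → List ℕ → Set
IsMaximal n λs = (μ : List ℕ) → IsPartition n μ → N13λ μ ≤ N13λ λs

maximal⇒N13λ-positive : ∀ {n λs} → IsMaximal n λs → 2 ≤ n → 1 ≤ N13λ λs
maximal⇒N13λ-positive {n} max 2≤n with twosAndThrees n 2≤n
... | T , c , N≡1 = subst (_≤ _) (trans (N13λ-↭ (sort-↭ T)) N≡1) (max (sort T) (isPartition-sort c))

record Improves (S T : List ℕ) : Set where
  field
    composition : IsComposition (sum S) T
    larger      : N13λ S < N13λ T

maximal⇒¬Improves : ∀ {n λs S R T} → IsMaximal n λs → IsPartition n λs → 1 ≤ N13λ λs →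
                     λs ↭ S ++ R → ¬ Improves S T
maximal⇒¬Improves {n} {λs} {S} {R} {T} max λs-part pos λs↭ imp =
  <⇒≱ (subst₂ _<_ (sym λs≡) (sym μ≡) (*-monoˡ-< (N13λ R) {{R≢0}} larger))
      (max (sort (T ++ R)) (isPartition-sort μ-comp))
  where
  open Improves imp
  open IsComposition composition
  λs≡ : N13λ λs ≡ N13λ S * N13λ R
  λs≡ = trans (N13λ-↭ λs↭) (N13λ-++ S R)
  μ≡ : N13λ (sort (T ++ R)) ≡ N13λ T * N13λ R
  μ≡ = trans (N13λ-↭ (sort-↭ (T ++ R))) (N13λ-++ T R)
  R≢0 : NonZero (N13λ R)
  R≢0 = ≢-nonZero λ R≡0 → <⇒≱ pos (≤-reflexive (trans λs≡ (trans (cong (N13λ S *_) R≡0) (*-zeroʳ (N13λ S)))))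
  μ-comp : IsComposition n (T ++ R)
  μ-comp = record
    { positive = ++⁺ positive (++⁻ʳ S (All-resp-↭ λs↭ (IsPartition.positive λs-part)))
    ; sums     = begin
        sum (T ++ R)      ≡⟨ sum-++ T R ⟩
        sum T + sum R     ≡⟨ cong (_+ sum R) sums ⟩
        sum S + sum R     ≡⟨ sum-++ S R ⟨
        sum (S ++ R)      ≡⟨ sum-↭ λs↭ ⟨
        sum λs            ≡⟨ IsPartition.sums λs-part ⟩
        n                 ∎
    }
    where open ≡-Reasoning

#partsBounded : ℕ → ℕ → ℕ → ℕ
#partsBounded fuel m k = length (partsBounded fuel m k)

private
  module _ (fuel m k : ℕ) where
    fits : ℕ → Bool
    fits j = j ≤ᵇ suc m
    extend : ℕ → List (List ℕ)
    extend j = map (j ∷_) (partsBounded fuel (suc m ∸ j) j)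

    #partsBounded-snoc : #partsBounded (suc fuel) (suc m) (suc k) ≡
      #partsBounded (suc fuel) (suc m) k + length (concatMap extend (filterᵇ fits (suc k ∷ [])))
    #partsBounded-snoc = begin
      length (concatMap extend (filterᵇ fits (applyUpTo suc (suc k))))
        ≡⟨ cong (λ js → length (concatMap extend (filterᵇ fits js))) (applyUpTo-∷ʳ suc k) ⟨
      length (concatMap extend (filterᵇ fits (applyUpTo suc k ∷ʳ suc k)))
        ≡⟨ cong (length ∘ concatMap extend) (filter-++ (T? ∘ fits) (applyUpTo suc k) (suc k ∷ [])) ⟩
      length (concatMap extend (filterᵇ fits (applyUpTo suc k) ++ filterᵇ fits (suc k ∷ [])))
        ≡⟨ cong length (concatMap-++ extend (filterᵇ fits (applyUpTo suc k)) _) ⟩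
      length (concatMap extend (filterᵇ fits (applyUpTo suc k)) ++ concatMap extend (filterᵇ fits (suc k ∷ [])))
        ≡⟨ length-++ (concatMap extend (filterᵇ fits (applyUpTo suc k))) ⟩
      #partsBounded (suc fuel) (suc m) k + length (concatMap extend (filterᵇ fits (suc k ∷ []))) ∎
      where open ≡-Reasoning

#partsBounded-split : ∀ fuel {m k} → k ≤ m →
  #partsBounded (suc fuel) (suc m) (suc k) ≡ #partsBounded (suc fuel) (suc m) k + #partsBounded fuel (m ∸ k) (suc k)
#partsBounded-split fuel {m} {k} k≤m with k <ᵇ suc m in fits | #partsBounded-snoc fuel m k
... | true  | eq = trans eq (cong (#partsBounded (suc fuel) (suc m) k +_)
        (trans (length-++ (map (suc k ∷_) parts)) (trans (+-identityʳ _) (length-map (suc k ∷_) parts))))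
  where parts = partsBounded fuel (m ∸ k) (suc k)
... | false | _  = contradiction (<⇒<ᵇ (s≤s k≤m)) (subst T fits)

#partsBounded-saturated : ∀ fuel {m k} → m < k →
  #partsBounded (suc fuel) (suc m) (suc k) ≡ #partsBounded (suc fuel) (suc m) k
#partsBounded-saturated fuel {m} {k} m<k with k <ᵇ suc m in fits | #partsBounded-snoc fuel m k
... | true  | _  = contradiction (<ᵇ⇒< k (suc m) (subst T (sym fits) tt)) (<⇒≱ (s≤s m<k))
... | false | eq = trans eq (+-identityʳ _)

module _ (B : ℕ → ℕ → ℕ → Set)
  (empty     : ∀ k → B 0 k 1)
  (none      : ∀ m k → B (suc m) k 0)
  (split     : ∀ {m k s₁ s₂} → k ≤ m → B (suc m) k s₁ → B (m ∸ k) (suc k) s₂ → B (suc m) (suc k) (s₁ + s₂))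
  (saturated : ∀ {m k s} → m < k → B (suc m) k s → B (suc m) (suc k) s)
  where

  #partsBounded-induction : ∀ fuel m k → B m k (#partsBounded fuel m k)
  #partsBounded-induction zero       zero    k       = empty k
  #partsBounded-induction (suc fuel) zero    k       = empty k
  #partsBounded-induction zero       (suc m) k       = none m k
  #partsBounded-induction (suc fuel) (suc m) zero    = none m zero
  #partsBounded-induction (suc fuel) (suc m) (suc k) with k ≤? m
  ... | yes k≤m = subst (B (suc m) (suc k)) (sym (#partsBounded-split fuel k≤m))
        (split k≤m (#partsBounded-induction (suc fuel) (suc m) k) (#partsBounded-induction fuel (m ∸ k) (suc k)))
  ... | no k≰m  = subst (B (suc m) (suc k)) (sym (#partsBounded-saturated fuel (≰⇒> k≰m)))
        (saturated (≰⇒> k≰m) (#partsBounded-induction (suc fuel) (suc m) k))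

-- p(m,k), the number of partitions of m into parts ≤ k, by dynamic programming:
-- partitionRows m = [row m, …, row 0] with row j = [p(j,0), …, p(j,j)], and p(j,k) = p(j,j) for k ≥ j
-- is read off by clampedLookup. Entry k of the next row sums p(m + 1 − i, i) over the largest part
-- i ≤ k; withNextRow shares the previous rows, so that evaluation stays polynomial.
clampedLookup : List ℕ → ℕ → ℕ
clampedLookup []           _       = 0
clampedLookup (x ∷ _)      zero    = x
clampedLookup (x ∷ [])     (suc k) = x
clampedLookup (_ ∷ y ∷ ys) (suc k) = clampedLookup (y ∷ ys) k

headRow : List (List ℕ) → List ℕ
headRow []      = []
headRow (r ∷ _) = r

runningSums : ℕ → ℕ → List (List ℕ) → List ℕ
runningSumsFrom : ℕ → ℕ → List (List ℕ) → List ℕ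

runningSums acc j rs = acc ∷ runningSumsFrom acc j rs

runningSumsFrom acc j []       = []
runningSumsFrom acc j (r ∷ rs) = runningSums (acc + clampedLookup r j) (suc j) rs

withNextRow : List (List ℕ) → List (List ℕ)
withNextRow rs = runningSums 0 1 rs ∷ rs

partitionRows : ℕ → List (List ℕ)
partitionRows zero    = (1 ∷ []) ∷ []
partitionRows (suc m) = withNextRow (partitionRows m)

partitionCount : ℕ → ℕ → ℕ
partitionCount m k = clampedLookup (headRow (partitionRows m)) k

length-runningSums : ∀ acc j rs → length (runningSums acc j rs) ≡ suc (length rs)
length-runningSums acc j []       = refl
length-runningSums acc j (r ∷ rs) = cong suc (length-runningSums _ (suc j) rs)

length-partitionRows : ∀ m → length (partitionRows m) ≡ suc m
length-partitionRows zero    = refl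
length-partitionRows (suc m) = cong suc (length-partitionRows m)

drop-partitionRows : ∀ {m k} → k ≤ m → drop k (partitionRows m) ≡ partitionRows (m ∸ k)
drop-partitionRows {m}     {zero}  _         = refl
drop-partitionRows {suc m} {suc k} (s≤s k≤m) = drop-partitionRows k≤m

clampedLookup-saturated : ∀ xs {k} → length xs ≤ suc k → clampedLookup xs (suc k) ≡ clampedLookup xs k
clampedLookup-saturated []                   _         = refl
clampedLookup-saturated (x ∷ [])     {zero}  _         = refl
clampedLookup-saturated (x ∷ [])     {suc k} _         = refl
clampedLookup-saturated (x ∷ y ∷ ys) {suc k} (s≤s len) = clampedLookup-saturated (y ∷ ys) len

runningSums-step : ∀ acc j rs {k} → k < length rs →
  clampedLookup (runningSums acc j rs) (suc k) ≡
  clampedLookup (runningSums acc j rs) k + clampedLookup (headRow (drop k rs)) (j + k)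
runningSums-step acc j (r ∷ _)       {zero}  _ = cong (λ i → acc + clampedLookup r i) (sym (+-identityʳ j))
runningSums-step acc j (r ∷ r′ ∷ rs) {suc k} (s≤s k<len) =
  trans (runningSums-step (acc + clampedLookup r j) (suc j) (r′ ∷ rs) k<len)
        (cong (clampedLookup (runningSums (acc + clampedLookup r j) (suc j) (r′ ∷ rs)) k +_)
              (cong (clampedLookup (headRow (drop k (r′ ∷ rs)))) (sym (+-suc j k))))

partitionCount-split : ∀ {m k} → k ≤ m →
  partitionCount (suc m) (suc k) ≡ partitionCount (suc m) k + partitionCount (m ∸ k) (suc k)
partitionCount-split {m} {k} k≤m =
  trans (runningSums-step 0 1 (partitionRows m) (subst (k <_) (sym (length-partitionRows m)) (s≤s k≤m)))
        (cong (λ rs → partitionCount (suc m) k + clampedLookup (headRow rs) (suc k)) (drop-partitionRows k≤m))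

partitionCount-saturated : ∀ {m k} → m < k → partitionCount (suc m) (suc k) ≡ partitionCount (suc m) k
partitionCount-saturated {m} m<k = clampedLookup-saturated (runningSums 0 1 (partitionRows m))
  (≤-trans (≤-reflexive (trans (length-runningSums 0 1 (partitionRows m)) (cong suc (length-partitionRows m))))
           (s≤s m<k))

#partsBounded≤partitionCount : ∀ fuel m k → #partsBounded fuel m k ≤ partitionCount m k
#partsBounded≤partitionCount = #partsBounded-induction (λ m k s → s ≤ partitionCount m k)
  (λ { zero → ≤-refl ; (suc _) → ≤-refl }) (λ _ _ → z≤n)
  (λ k≤m s₁≤ s₂≤ → ≤-trans (+-mono-≤ s₁≤ s₂≤) (≤-reflexive (sym (partitionCount-split k≤m))))
  (λ m<k s≤ → ≤-trans s≤ (≤-reflexive (sym (partitionCount-saturated m<k))))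


-- With x = 5/6, ProductBound m k s says s ≤ x⁻ᵐ E k / D k = x⁻ᵐ ∏_{j ≤ k} (1 − xʲ)⁻¹, the
-- generating-function bound for partitions of m into parts ≤ k, and TailBound m k s says
-- s ≤ A x⁻ᵐ (1 − 5xᵏ); the recurrence preserves the latter since 5 (1 − x) = x, and A is large
-- enough to switch to it at k = 40.
-- Implicit arguments are passed explicitly: unifying against a term 1401 * t would make Agda unfold
-- the multiplication by a large literal.
module ExponentialBound where

  A : ℕ
  A = 1401

  D E : ℕ → ℕ
  D zero    = 1
  D (suc k) = D k * (6 ^ suc k ∸ 5 ^ suc k)
  E zero    = 1
  E (suc k) = E k * 6 ^ suc k

  ProductBound TailBound Bound : ℕ → ℕ → ℕ → Set
  ProductBound m k s = 5 ^ m * D k * s ≤ 6 ^ m * E k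
  TailBound    m k s = 5 ^ m * 6 ^ k * s + A * 5 ^ suc k * 6 ^ m ≤ A * 6 ^ k * 6 ^ m
  Bound        m k s = (k ≤ 40 → ProductBound m k s) × (41 ≤ k → TailBound m k s)

  ^-split : ∀ b {m k} → k ≤ m → b ^ suc m ≡ b ^ suc k * b ^ (m ∸ k)
  ^-split b {m} {k} k≤m = trans (cong (λ e → b ^ suc e) (sym (m+[n∸m]≡n k≤m))) (^-distribˡ-+-* b (suc k) (m ∸ k))

  5^≤6^ : ∀ n → 5 ^ n ≤ 6 ^ n
  5^≤6^ n = ^-monoˡ-≤ n (s≤s (s≤s (s≤s (s≤s (s≤s z≤n)))))

  D≤E : ∀ k → D k ≤ E k
  D≤E zero    = ≤-refl
  D≤E (suc k) = *-mono-≤ (D≤E k) (m∸n≤m (6 ^ suc k) (5 ^ suc k))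

  tail-base : ∀ {k} → 41 ≤ k → 6 ^ k + A * 5 ^ suc k ≤ A * 6 ^ k
  tail-base {k} 41≤k = subst (λ i → 6 ^ i + A * 5 ^ suc i ≤ A * 6 ^ i) (m∸n+n≡m 41≤k) (go (k ∸ 41))
    where
    step : ∀ t s → t + A * s ≤ A * t → 6 * t + A * (5 * s) ≤ A * (6 * t)
    step t s h = ≤-trans (m≤m+n _ (A * s)) (subst₂ _≤_ (e₁ A t s) (e₂ A t s) (*-monoʳ-≤ 6 h))
      where
      e₁ : ∀ A t s → 6 * (t + A * s) ≡ 6 * t + A * (5 * s) + A * s
      e₁ = solve-∀
      e₂ : ∀ A t s → 6 * (A * t) ≡ A * (6 * t)
      e₂ = solve-∀
    go : ∀ d → 6 ^ (d + 41) + A * 5 ^ suc (d + 41) ≤ A * 6 ^ (d + 41)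
    go zero    = ≤ᵇ⇒≤ _ _ tt
    go (suc d) = step (6 ^ (d + 41)) (5 ^ suc (d + 41)) (go d)

  product-split : ∀ {m k s₁ s₂} → k ≤ m →
    ProductBound (suc m) k s₁ → ProductBound (m ∸ k) (suc k) s₂ → ProductBound (suc m) (suc k) (s₁ + s₂)
  product-split {m} {k} {s₁} {s₂} k≤m =
    combine (^-split 5 k≤m) (^-split 6 k≤m) (m∸n+n≡m (5^≤6^ (suc k)))
    where
    combine : ∀ {X Y a b c d δ Dk Ek} → X ≡ a * c → Y ≡ b * d → δ + a ≡ b →
      X * Dk * s₁ ≤ Y * Ek → c * (Dk * δ) * s₂ ≤ d * (Ek * b) → X * (Dk * δ) * (s₁ + s₂) ≤ Y * (Ek * b)
    combine {a = a} {c = c} {d} {δ} {Dk} {Ek} refl refl refl h₁ h₂ =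
      subst₂ _≤_ (e₁ a c δ Dk s₁ s₂) (e₂ a d δ Ek) (+-mono-≤ (*-monoʳ-≤ δ h₁) (*-monoʳ-≤ a h₂))
      where
      e₁ : ∀ a c δ Dk s₁ s₂ → δ * (a * c * Dk * s₁) + a * (c * (Dk * δ) * s₂) ≡ a * c * (Dk * δ) * (s₁ + s₂)
      e₁ = solve-∀
      e₂ : ∀ a d δ Ek → δ * ((δ + a) * d * Ek) + a * (d * (Ek * (δ + a))) ≡ (δ + a) * d * (Ek * (δ + a))
      e₂ = solve-∀

  product-weaken : ∀ {m k s} → ProductBound m k s → ProductBound m (suc k) s
  product-weaken {m} {k} {s} h = subst₂ _≤_ (e₁ (5 ^ m) (D k) δ s) (e₂ (6 ^ m) (E k) (6 ^ suc k))
    (*-mono-≤ (m∸n≤m (6 ^ suc k) (5 ^ suc k)) h)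
    where
    δ = 6 ^ suc k ∸ 5 ^ suc k
    e₁ : ∀ X Dk δ s → δ * (X * Dk * s) ≡ X * (Dk * δ) * s
    e₁ = solve-∀
    e₂ : ∀ Y Ek b → b * (Y * Ek) ≡ Y * (Ek * b)
    e₂ = solve-∀

  tail-split : ∀ {m k s₁ s₂} → k ≤ m →
    TailBound (suc m) k s₁ → TailBound (m ∸ k) (suc k) s₂ → TailBound (suc m) (suc k) (s₁ + s₂)
  tail-split {m} {k} {s₁} {s₂} k≤m =
    combine {5 ^ suc m} {6 ^ suc m} {6 ^ k} {5 ^ suc k} {5 ^ (m ∸ k)} {6 ^ (m ∸ k)} (^-split 5 k≤m) (^-split 6 k≤m)
    where
    combine : ∀ {X Y w u Q P} → X ≡ u * Q → Y ≡ (6 * w) * P →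
      X * w * s₁ + A * u * Y ≤ A * w * Y →
      Q * (6 * w) * s₂ + A * (5 * u) * P ≤ A * (6 * w) * P →
      X * (6 * w) * (s₁ + s₂) + A * (5 * u) * Y ≤ A * (6 * w) * Y
    combine {w = w} {u} {Q} {P} refl refl h₁ h₂ =
      ≤-trans (m≤m+n _ (5 * A * u * u * P))
        (+-cancelˡ-≤ (A * u * (6 * w * P)) _ _
          (subst₂ _≤_ (e₁ A w u Q P s₁ s₂) (e₂ A w u P) (+-mono-≤ (*-monoʳ-≤ 6 h₁) (*-monoʳ-≤ u h₂))))
      where
      e₁ : ∀ A w u Q P s₁ s₂ →
        6 * (u * Q * w * s₁ + A * u * (6 * w * P)) + u * (Q * (6 * w) * s₂ + A * (5 * u) * P)
        ≡ A * u * (6 * w * P) + (u * Q * (6 * w) * (s₁ + s₂) + A * (5 * u) * (6 * w * P) + 5 * A * u * u * P)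
      e₁ = solve-∀
      e₂ : ∀ A w u P →
        6 * (A * w * (6 * w * P)) + u * (A * (6 * w) * P) ≡ A * u * (6 * w * P) + A * (6 * w) * (6 * w * P)
      e₂ = solve-∀

  tail-weaken : ∀ {m k s} → TailBound m k s → TailBound m (suc k) s
  tail-weaken {m} {k} {s} h =
    ≤-trans (m≤m+n _ (A * 5 ^ suc k * 6 ^ m))
      (subst₂ _≤_ (e₁ A (5 ^ m) (6 ^ m) (6 ^ k) (5 ^ suc k) s) (e₂ A (6 ^ m) (6 ^ k)) (*-monoʳ-≤ 6 h))
    where
    e₁ : ∀ A X Y w u s → 6 * (X * w * s + A * u * Y) ≡ X * (6 * w) * s + A * (5 * u) * Y + A * u * Y
    e₁ = solve-∀
    e₂ : ∀ A Y w → 6 * (A * w * Y) ≡ A * (6 * w) * Y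
    e₂ = solve-∀

  instance
    D40-nonZero : NonZero (D 40)
    D40-nonZero = _

  switch-split : ∀ {m k s₁ s₂} → k ≡ 40 → k ≤ m →
    ProductBound (suc m) k s₁ → TailBound (m ∸ k) (suc k) s₂ → TailBound (suc m) (suc k) (s₁ + s₂)
  switch-split {m} {s₁ = s₁} {s₂} refl 40≤m h₁ h₂ =
    combine {D 40} {E 40} {5 ^ suc m} {6 ^ suc m} {5 ^ 41} {6 ^ 41} {5 ^ (m ∸ 40)} {6 ^ (m ∸ 40)}
      (^-split 5 40≤m) (^-split 6 40≤m) (≤ᵇ⇒≤ _ _ tt) h₁ h₂
    where
    open ≤-Reasoning
    combine : ∀ {Dn En X Y u v Q P} .{{_ : NonZero Dn}} → X ≡ u * Q → Y ≡ v * P →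
      En * (v * v) + 6 * A * Dn * u * v ≤ A * Dn * (v * v) + 5 * A * Dn * u * u →
      X * Dn * s₁ ≤ Y * En →
      Q * v * s₂ + A * (5 * u) * P ≤ A * v * P →
      X * v * (s₁ + s₂) + A * (5 * u) * Y ≤ A * v * Y
    combine {Dn} {En} {u = u} {v} {Q} {P} refl refl c h₁ h₂ =
      *-cancelˡ-≤ Dn (+-cancelʳ-≤ (5 * A * Dn * u * u * P) _ _ (begin
        Dn * (u * Q * v * (s₁ + s₂) + A * (5 * u) * (v * P)) + 5 * A * Dn * u * u * P
          ≡⟨ e₁ A Dn u v Q P s₁ s₂ ⟩
        v * (u * Q * Dn * s₁) + u * Dn * (Q * v * s₂ + A * (5 * u) * P) + 5 * A * Dn * u * v * P
          ≤⟨ +-monoˡ-≤ (5 * A * Dn * u * v * P) (+-mono-≤ (*-monoʳ-≤ v h₁) (*-monoʳ-≤ (u * Dn) h₂)) ⟩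
        v * (v * P * En) + u * Dn * (A * v * P) + 5 * A * Dn * u * v * P
          ≡⟨ e₂ A Dn En u v P ⟩
        P * (En * (v * v) + 6 * A * Dn * u * v)
          ≤⟨ *-monoʳ-≤ P c ⟩
        P * (A * Dn * (v * v) + 5 * A * Dn * u * u)
          ≡⟨ e₃ A Dn u v P ⟩
        Dn * (A * v * (v * P)) + 5 * A * Dn * u * u * P ∎))
      where
      e₁ : ∀ A Dn u v Q P s₁ s₂ → Dn * (u * Q * v * (s₁ + s₂) + A * (5 * u) * (v * P)) + 5 * A * Dn * u * u * P
          ≡ v * (u * Q * Dn * s₁) + u * Dn * (Q * v * s₂ + A * (5 * u) * P) + 5 * A * Dn * u * v * P
      e₁ = solve-∀
      e₂ : ∀ A Dn En u v P → v * (v * P * En) + u * Dn * (A * v * P) + 5 * A * Dn * u * v * P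
          ≡ P * (En * (v * v) + 6 * A * Dn * u * v)
      e₂ = solve-∀
      e₃ : ∀ A Dn u v P → P * (A * Dn * (v * v) + 5 * A * Dn * u * u) ≡ Dn * (A * v * (v * P)) + 5 * A * Dn * u * u * P
      e₃ = solve-∀

  switch-weaken : ∀ {m k s} → k ≡ 40 → ProductBound m k s → TailBound m (suc k) s
  switch-weaken {m} {s = s} refl h = combine {D 40} {E 40} {5 ^ m} {6 ^ m} {5 ^ 41} {6 ^ 41} (≤ᵇ⇒≤ _ _ tt) h
    where
    open ≤-Reasoning
    combine : ∀ {Dn En X Y u v} .{{_ : NonZero Dn}} →
      En * v + 5 * A * Dn * u ≤ A * Dn * v → X * Dn * s ≤ Y * En → X * v * s + A * (5 * u) * Y ≤ A * v * Y
    combine {Dn} {En} {X} {Y} {u} {v} c h = *-cancelˡ-≤ Dn (begin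
      Dn * (X * v * s + A * (5 * u) * Y) ≡⟨ e₁ A Dn X Y u v s ⟩
      v * (X * Dn * s) + 5 * A * Dn * u * Y ≤⟨ +-monoˡ-≤ (5 * A * Dn * u * Y) (*-monoʳ-≤ v h) ⟩
      v * (Y * En) + 5 * A * Dn * u * Y ≡⟨ e₂ A Dn En Y u v ⟩
      Y * (En * v + 5 * A * Dn * u) ≤⟨ *-monoʳ-≤ Y c ⟩
      Y * (A * Dn * v) ≡⟨ e₃ A Dn Y v ⟩
      Dn * (A * v * Y) ∎)
      where
      e₁ : ∀ A Dn X Y u v s → Dn * (X * v * s + A * (5 * u) * Y) ≡ v * (X * Dn * s) + 5 * A * Dn * u * Y
      e₁ = solve-∀
      e₂ : ∀ A Dn En Y u v → v * (Y * En) + 5 * A * Dn * u * Y ≡ Y * (En * v + 5 * A * Dn * u)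
      e₂ = solve-∀
      e₃ : ∀ A Dn Y v → Y * (A * Dn * v) ≡ Dn * (A * v * Y)
      e₃ = solve-∀

  bound-empty : ∀ k → Bound 0 k 1
  bound-empty k =
      (λ _ → subst₂ _≤_ (e₁ (D k)) (e₂ (E k)) (D≤E k))
    , (λ 41≤k → subst₂ _≤_ (e₃ (6 ^ k) (A * 5 ^ suc k)) (sym (*-identityʳ (A * 6 ^ k))) (tail-base 41≤k))
    where
    e₁ : ∀ x → x ≡ 1 * x * 1
    e₁ = solve-∀
    e₂ : ∀ x → x ≡ 1 * x
    e₂ = solve-∀
    e₃ : ∀ x y → x + y ≡ 1 * x * 1 + y * 1
    e₃ = solve-∀

  bound-none : ∀ m k → Bound (suc m) k 0
  bound-none m k =
      (λ _ → subst (_≤ 6 ^ suc m * E k) (sym (*-zeroʳ (5 ^ suc m * D k))) z≤n)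
    , (λ 41≤k → subst (_≤ A * 6 ^ k * 6 ^ suc m) (cong (_+ A * 5 ^ suc k * 6 ^ suc m) (sym (*-zeroʳ (5 ^ suc m * 6 ^ k))))
         (*-monoˡ-≤ (6 ^ suc m) (≤-trans (m≤n+m (A * 5 ^ suc k) (6 ^ k)) (tail-base 41≤k))))

  bound-split : ∀ {m k s₁ s₂} → k ≤ m →
    Bound (suc m) k s₁ → Bound (m ∸ k) (suc k) s₂ → Bound (suc m) (suc k) (s₁ + s₂)
  bound-split {m} {k} {s₁} {s₂} k≤m (p₁ , t₁) (p₂ , t₂) =
    (λ k<40 → product-split {m} {k} {s₁} {s₂} k≤m (p₁ (<⇒≤ k<40)) (p₂ k<40)) , tail (k ≤? 40)
    where
    tail : Dec (k ≤ 40) → 41 ≤ suc k → TailBound (suc m) (suc k) (s₁ + s₂)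
    tail (no k≰40)  41≤1+k = tail-split {m} {k} {s₁} {s₂} k≤m (t₁ (≰⇒> k≰40)) (t₂ 41≤1+k)
    tail (yes k≤40) 41≤1+k =
      switch-split {m} {k} {s₁} {s₂} (≤-antisym k≤40 (s≤s⁻¹ 41≤1+k)) k≤m (p₁ k≤40) (t₂ 41≤1+k)

  bound-saturated : ∀ {m k s} → Bound m k s → Bound m (suc k) s
  bound-saturated {m} {k} {s} (p , t) = (λ k<40 → product-weaken {m} {k} {s} (p (<⇒≤ k<40))) , tail (k ≤? 40)
    where
    tail : Dec (k ≤ 40) → 41 ≤ suc k → TailBound m (suc k) s
    tail (no k≰40)  41≤1+k = tail-weaken {m} {k} {s} (t (≰⇒> k≰40))
    tail (yes k≤40) 41≤1+k = switch-weaken {m} {k} {s} (≤-antisym k≤40 (s≤s⁻¹ 41≤1+k)) (p k≤40)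

  #partsBounded-exponential : ∀ fuel {m} → 41 ≤ m → 5 ^ m * #partsBounded fuel m m ≤ A * 6 ^ m
  #partsBounded-exponential fuel {m} 41≤m =
    *-cancelʳ-≤ _ _ (6 ^ m) {{m^n≢0 6 m}}
      (≤-trans (m≤m+n _ _) (subst (λ x → x + A * 5 ^ suc m * 6 ^ m ≤ A * 6 ^ m * 6 ^ m) (e (5 ^ m) (6 ^ m) count)
        (proj₂ (#partsBounded-induction Bound bound-empty bound-none bound-split
          (λ {m} {k} {s} _ → bound-saturated {suc m} {k} {s}) fuel m m) 41≤m)))
    where
    count = #partsBounded fuel m m
    e : ∀ x y s → x * y * s ≡ x * s * y
    e = solve-∀

open ExponentialBound using (A; #partsBounded-exponential)

-- N(1,3;m) for m < 36, tabulated because evaluating N13 enumerates all partitions of m.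
N13-values : List ℕ
N13-values = 0 ∷ 0 ∷ 1 ∷ 1 ∷ 1 ∷ 3 ∷ 4 ∷ 4 ∷ 8 ∷ 10 ∷ 13 ∷ 20 ∷ 26 ∷ 32 ∷ 46 ∷ 59 ∷ 75 ∷ 101 ∷ 129 ∷ 161 ∷
  211 ∷ 264 ∷ 331 ∷ 421 ∷ 526 ∷ 649 ∷ 815 ∷ 1004 ∷ 1235 ∷ 1526 ∷ 1869 ∷ 2275 ∷ 2787 ∷ 3382 ∷ 4097 ∷ 4967 ∷ []

N13ᵗ : ℕ → ℕ
N13ᵗ = clampedLookup N13-values

N13λᵗ : List ℕ → ℕ
N13λᵗ T = product (map N13ᵗ T)

N13≡N13ᵗ : ∀ {m} → m < 36 → N13 m ≡ N13ᵗ m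
N13≡N13ᵗ = from-yes (allUpTo? (λ m → N13 m ≟ N13ᵗ m) 36)

N13λ≡N13λᵗ : ∀ {T} → All (_< 36) T → N13λ T ≡ N13λᵗ T
N13λ≡N13λᵗ []         = refl
N13λ≡N13λᵗ (x<36 ∷ p) = cong₂ _*_ (N13≡N13ᵗ x<36) (N13λ≡N13λᵗ p)

improvementBase : ℕ → List ℕ
improvementBase 0  = 11 ∷ 11 ∷ []
improvementBase 1  = 12 ∷ 11 ∷ []
improvementBase 2  = 12 ∷ 12 ∷ []
improvementBase 3  = 14 ∷ 11 ∷ []
improvementBase 4  = 14 ∷ 12 ∷ []
improvementBase 5  = 15 ∷ 12 ∷ []
improvementBase 6  = 14 ∷ 14 ∷ []
improvementBase 7  = 15 ∷ 14 ∷ []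
improvementBase 8  = 15 ∷ 15 ∷ []
improvementBase 9  = 17 ∷ 14 ∷ []
improvementBase 10 = 17 ∷ 15 ∷ []
improvementBase 11 = 11 ∷ 11 ∷ 11 ∷ []
improvementBase 12 = 12 ∷ 11 ∷ 11 ∷ []
improvementBase 13 = 12 ∷ 12 ∷ 11 ∷ []
improvementBase _  = []

improvement : ℕ → ℕ → List ℕ
improvement q r = replicate q 14 ++ improvementBase r

record Improvesᵗ (S T : List ℕ) : Set where
  field
    parts  : All (λ x → 1 ≤ x × x < 36) T
    sums   : sum T ≡ sum S
    larger : N13λᵗ S < N13λᵗ T

improvesᵗ? : ∀ S T → Dec (Improvesᵗ S T)
improvesᵗ? S T =
  map′ (λ (p , s , l) → record { parts = p ; sums = s ; larger = l }) (λ i → parts i , sums i , larger i)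
       (all? (λ x → 1 ≤? x ×-dec x <? 36) T ×-dec sum T ≟ sum S ×-dec N13λᵗ S <? N13λᵗ T)
  where open Improvesᵗ

Improvesᵗ⇒Improves : ∀ {S T} → All (_< 36) S → Improvesᵗ S T → Improves S T
Improvesᵗ⇒Improves {S} {T} S<36 i = record
  { composition = record { positive = All.map proj₁ parts ; sums = sums }
  ; larger      = subst₂ _<_ (sym (N13λ≡N13λᵗ S<36)) (sym (N13λ≡N13λᵗ (All.map proj₂ parts))) larger
  }
  where open Improvesᵗ i

improvementBase-improves : ∀ {r} → r < 14 → Improvesᵗ (22 + r ∷ []) (improvementBase r)
improvementBase-improves = from-yes (allUpTo? (λ r → improvesᵗ? (22 + r ∷ []) (improvementBase r)) 14)

partitionCount<improvement : ∀ {q} → q < 4 → ∀ {r} → r < 14 →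
  let m = sum (improvement (suc q) r) in partitionCount m m < N13λᵗ (improvement (suc q) r)
partitionCount<improvement = from-yes (allUpTo? (λ q → allUpTo? (λ r →
  let m = sum (improvement (suc q) r) in partitionCount m m <? N13λᵗ (improvement (suc q) r)) 14) 4)

-- A record, so that comparing two instances compares m and P instead of unfolding A * 6 ^ m.
record AboveExponential (m P : ℕ) : Set where
  constructor aboveExponential
  field
    bound : A * 6 ^ m < 5 ^ m * P

aboveExponential-14+ : ∀ {m P} → AboveExponential m P → AboveExponential (14 + m) (46 * P)
aboveExponential-14+ {m} {P} (aboveExponential h) = aboveExponential (begin-strict
  A * 6 ^ (14 + m)          ≡⟨ cong (A *_) (^-distribˡ-+-* 6 14 m) ⟩
  A * (6 ^ 14 * 6 ^ m)      ≡⟨ e₁ A (6 ^ 14) (6 ^ m) ⟩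
  6 ^ 14 * (A * 6 ^ m)      <⟨ *-monoʳ-< (6 ^ 14) h ⟩
  6 ^ 14 * (5 ^ m * P)      ≤⟨ *-monoˡ-≤ (5 ^ m * P) (≤ᵇ⇒≤ (6 ^ 14) (46 * 5 ^ 14) _) ⟩
  46 * 5 ^ 14 * (5 ^ m * P) ≡⟨ e₂ (5 ^ 14) (5 ^ m) P ⟩
  5 ^ 14 * 5 ^ m * (46 * P) ≡⟨ cong (_* (46 * P)) (^-distribˡ-+-* 5 14 m) ⟨
  5 ^ (14 + m) * (46 * P)   ∎)
  where
  open ≤-Reasoning
  e₁ : ∀ a s t → a * (s * t) ≡ s * (a * t)
  e₁ = solve-∀
  e₂ : ∀ s t P → 46 * s * (t * P) ≡ s * t * (46 * P)
  e₂ = solve-∀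

aboveExponential? : ∀ m P → Dec (AboveExponential m P)
aboveExponential? m P = map′ aboveExponential AboveExponential.bound (A * 6 ^ m <? 5 ^ m * P)

ImprovementAboveExponential : ℕ → ℕ → Set
ImprovementAboveExponential q r = AboveExponential (sum (improvement q r)) (N13λᵗ (improvement q r))

improvement₅-aboveExponential : ∀ {r} → r < 14 → ImprovementAboveExponential 5 r
improvement₅-aboveExponential =
  from-yes (allUpTo? (λ r → aboveExponential? (sum (improvement 5 r)) (N13λᵗ (improvement 5 r))) 14)

improvement-aboveExponential : ∀ d {r} → r < 14 → ImprovementAboveExponential (5 + d) r
improvement-aboveExponential zero    = improvement₅-aboveExponential
improvement-aboveExponential (suc d) r<14 = aboveExponential-14+ (improvement-aboveExponential d r<14)

N13≤#partsBounded : ∀ m → N13 m ≤ #partsBounded m m m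
N13≤#partsBounded m = length-filter (T? ∘ rankIs1mod3) (partitions m)

N13≤partitionCount : ∀ m → N13 m ≤ partitionCount m m
N13≤partitionCount m = ≤-trans (N13≤#partsBounded m) (#partsBounded≤partitionCount m m m)

aboveExponential⇒N13< : ∀ {m P} → 41 ≤ m → AboveExponential m P → N13 m < P
aboveExponential⇒N13< {m} {P} 41≤m (aboveExponential h) = *-cancelˡ-< (5 ^ m) (N13 m) P
  (≤-<-trans (*-monoʳ-≤ (5 ^ m) (N13≤#partsBounded m)) (≤-<-trans (#partsBounded-exponential m 41≤m) h))

sum-improvement : ∀ q {r} → r < 14 → sum (improvement q r) ≡ q * 14 + (22 + r)
sum-improvement zero    r<14 = trans (Improvesᵗ.sums (improvementBase-improves r<14)) (+-identityʳ _)
sum-improvement (suc q) {r} r<14 =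
  trans (cong (14 +_) (sum-improvement q r<14)) (sym (+-assoc 14 (q * 14) (22 + r)))

N13<improvement : ∀ q {r} → r < 14 → N13 (sum (improvement q r)) < N13λᵗ (improvement q r)
N13<improvement zero {r} r<14 = begin-strict
  N13 (sum (improvementBase r)) ≡⟨ cong N13 (sum-improvement 0 r<14) ⟩
  N13 (22 + r)                  ≡⟨ N13≡N13ᵗ (+-monoʳ-< 22 r<14) ⟩
  N13ᵗ (22 + r)                 ≡⟨ *-identityʳ _ ⟨
  N13ᵗ (22 + r) * 1             <⟨ Improvesᵗ.larger (improvementBase-improves r<14) ⟩
  N13λᵗ (improvementBase r)     ∎
  where open ≤-Reasoning
N13<improvement (suc q) {r} r<14 = byRange (q <? 4)
  where
  byRange : Dec (q < 4) → N13 (sum (improvement (suc q) r)) < N13λᵗ (improvement (suc q) r)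
  byRange (yes q<4) =
    ≤-<-trans (N13≤partitionCount (sum (improvement (suc q) r))) (partitionCount<improvement q<4 r<14)
  byRange (no q≮4)  = subst (λ q → N13 (sum (improvement (suc q) r)) < N13λᵗ (improvement (suc q) r))
    (m+[n∸m]≡n (≮⇒≥ q≮4))
    (aboveExponential⇒N13< 41≤sum (improvement-aboveExponential (q ∸ 4) r<14))
    where
    41≤sum : 41 ≤ sum (improvement (5 + (q ∸ 4)) r)
    41≤sum = subst (41 ≤_) (sym (sum-improvement (5 + (q ∸ 4)) r<14))
      (≤-trans (≤ᵇ⇒≤ 41 70 _) (≤-trans (*-monoˡ-≤ 14 (m≤m+n 5 (q ∸ 4))) (m≤m+n _ (22 + r))))

improvement-improves : ∀ q {r} → r < 14 → Improves (sum (improvement q r) ∷ []) (improvement q r)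
improvement-improves q {r} r<14 = record
  { composition = record
    { positive = ++⁺ (replicate⁺ q (s≤s z≤n)) (All.map proj₁ parts)
    ; sums     = sym (+-identityʳ _)
    }
  ; larger = subst₂ _<_ (sym (*-identityʳ _))
                        (sym (N13λ≡N13λᵗ (++⁺ (replicate⁺ q (≤ᵇ⇒≤ 15 36 _)) (All.map proj₂ parts))))
                        (N13<improvement q r<14)
  }
  where open Improvesᵗ (improvementBase-improves r<14)

large-part-improvable : ∀ {a} → 22 ≤ a → Σ[ T ∈ List ℕ ] Improves (a ∷ []) T
large-part-improvable {a} 22≤a = improvement q r , subst (λ x → Improves (x ∷ []) (improvement q r)) sum≡a
  (improvement-improves q (m%n<n (a ∸ 22) 14))
  where
  q = (a ∸ 22) / 14
  r = (a ∸ 22) % 14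
  open ≡-Reasoning
  e : ∀ q r → q * 14 + (22 + r) ≡ 22 + (r + q * 14)
  e = solve-∀
  sum≡a : sum (improvement q r) ≡ a
  sum≡a = begin
    sum (improvement q r) ≡⟨ sum-improvement q (m%n<n (a ∸ 22) 14) ⟩
    q * 14 + (22 + r)     ≡⟨ e q r ⟩
    22 + (r + q * 14)     ≡⟨ cong (22 +_) (m≡m%n+[m/n]*n (a ∸ 22) 14) ⟨
    22 + (a ∸ 22)         ≡⟨ m+[n∸m]≡n 22≤a ⟩
    a                     ∎

exceptionalPairs : List (ℕ × ℕ)
exceptionalPairs = (12 , 11) ∷ (14 , 11) ∷ (14 , 12) ∷ (15 , 12) ∷ (15 , 14) ∷ (17 , 14) ∷ (17 , 15) ∷ []

pairReplacement : ℕ → List ℕ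
pairReplacement s = if s <ᵇ 22 then s ∷ [] else improvement ((s ∸ 22) / 14) ((s ∸ 22) % 14)

pair-check : ∀ {a} → a < 22 → ∀ {b} → b < a →
  b ≡ 0 ⊎ (a , b) ∈ exceptionalPairs ⊎ Improvesᵗ (a ∷ b ∷ []) (pairReplacement (a + b))
pair-check = from-yes (allUpTo? (λ a → allUpTo? (λ b →
  (b ≟ 0) ⊎-dec ((a , b) ∈? exceptionalPairs) ⊎-dec improvesᵗ? (a ∷ b ∷ []) (pairReplacement (a + b))) a) 22)

Conclusion : ℕ → ℕ → Set
Conclusion a b = (a ≡ 12 × b ≡ 11) ⊎ (a ≡ 15 × b ≡ 12) ⊎ (a ≡ 17 × b ≡ 15)

exceptional⇒conclusion : ∀ {a b} → a ≢ 14 → b ≢ 14 → (a , b) ∈ exceptionalPairs → Conclusion a b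
exceptional⇒conclusion _    _    (here refl)                                       = inj₁ (refl , refl)
exceptional⇒conclusion a≢14 _    (there (here refl))                               = ⊥-elim (a≢14 refl)
exceptional⇒conclusion a≢14 _    (there (there (here refl)))                       = ⊥-elim (a≢14 refl)
exceptional⇒conclusion _    _    (there (there (there (here refl))))               = inj₂ (inj₁ (refl , refl))
exceptional⇒conclusion _    b≢14 (there (there (there (there (here refl)))))       = ⊥-elim (b≢14 refl)
exceptional⇒conclusion _    b≢14 (there (there (there (there (there (here refl)))))) = ⊥-elim (b≢14 refl)
exceptional⇒conclusion _    _    (there (there (there (there (there (there (here refl))))))) = inj₂ (inj₂ (refl , refl))

pair-allowed-or-improvable : ∀ {a b} → a < 22 → b < a → 1 ≤ b → a ≢ 14 → b ≢ 14 →
  Conclusion a b ⊎ Σ[ T ∈ List ℕ ] Improves (a ∷ b ∷ []) T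
pair-allowed-or-improvable {a} {b} a<22 b<a 1≤b a≢14 b≢14 = byCheck (pair-check a<22 b<a)
  where
  a<36 = <-trans a<22 (≤ᵇ⇒≤ 23 36 tt)
  byCheck : b ≡ 0 ⊎ (a , b) ∈ exceptionalPairs ⊎ Improvesᵗ (a ∷ b ∷ []) (pairReplacement (a + b)) →
            Conclusion a b ⊎ Σ[ T ∈ List ℕ ] Improves (a ∷ b ∷ []) T
  byCheck (inj₁ b≡0)        = contradiction (subst (1 ≤_) b≡0 1≤b) λ ()
  byCheck (inj₂ (inj₁ exc)) = inj₁ (exceptional⇒conclusion a≢14 b≢14 exc)
  byCheck (inj₂ (inj₂ imp)) = inj₂ (_ , Improvesᵗ⇒Improves (a<36 ∷ <-trans b<a a<36 ∷ []) imp)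

proposition3p11 : (n : ℕ) → 1 ≤ n → (λs : List ℕ) → IsPartition n λs →
    ((μ : List ℕ) → IsPartition n μ → N13λ μ ≤ N13λ λs) →
    (a b : ℕ) → a > b → a ≢ 2 → a ≢ 14 → b ≢ 2 → b ≢ 14 →
    mult a λs ≡ 1 → mult b λs ≡ 1 →
    ((a ≡ 12 × b ≡ 11) ⊎ (a ≡ 15 × b ≡ 12) ⊎ (a ≡ 17 × b ≡ 15))
proposition3p11 n _ λs λs-part max a b b<a _ a≢14 _ b≢14 ma mb = byLargestPart (22 ≤? a)
  where
  a∈λs : a ∈ λs
  a∈λs = mult≡suc⇒∈ λs ma
  b∈λs : b ∈ λs
  b∈λs = mult≡suc⇒∈ λs mb
  1≤b : 1 ≤ b
  1≤b = All.lookup (IsPartition.positive λs-part) b∈λs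
  2≤n : 2 ≤ n
  2≤n = ≤-trans (≤-trans (s≤s 1≤b) b<a) (subst (a ≤_) (IsPartition.sums λs-part) (∈⇒≤sum a∈λs))
  ¬improves : ∀ {S R T} → λs ↭ S ++ R → ¬ Improves S T
  ¬improves = maximal⇒¬Improves {n} {λs} max λs-part (maximal⇒N13λ-positive {n} {λs} max 2≤n)
  byLargestPart : Dec (22 ≤ a) → Conclusion a b
  byLargestPart (yes 22≤a) = contradiction (proj₂ (large-part-improvable 22≤a)) (¬improves (proj₂ (∈⇒↭∷ a∈λs)))
  byLargestPart (no 22≰a)  =
    [ id , (λ (_ , imp) → contradiction imp (¬improves (proj₂ (∈×∈⇒↭∷∷ a∈λs b∈λs (>⇒≢ b<a))))) ]′
    (pair-allowed-or-improvable (≰⇒> 22≰a) b<a 1≤b a≢14 b≢14)
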